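{- Let $m,n\in\mathbb{N}$. Every dimension-preserving graph morphism $f:T_m\to T_n$ can be written in exactly one way as $f=h\circ g$ where, for some $k\in\mathbb{N}$, $g:T_m\to T_k$ is a dimension-preserving graph morphism surjective on vertices and $h:T_k\to T_n$ is a dimension-preserving graph morphism injective on vertices; that is, the map $(k,h,g)\mapsto h\circ g$ from the set of such triples to the set of dimension-preserving graph morphisms $T_m\to T_n$ is a bijection. Moreover, the dimension-preserving graph morphisms $T_m\to T_n$ are in bijection with the faces of $T_n$ of dimension at most $m$.
   Context: A graph is $(V,E)$ with $E\subseteq V\times V$; a graph morphism $(V,E)\to(V',E')$ is $f:V\to V'$ with $(s,t)\in E\Rightarrow(f(s),f(t))\in E'$, sending edge $(s,t)$ to edge $(f(s),f(t))$. The twisted $n$-cube $T_n$ has vertex set $\{0,1\}^n$ and edges: a loop at each vertex, and for each $i\in\{0,\dots,n-1\}$ and $y\in\{0,1\}^{n-1}$ an edge from $y_0\cdots y_{i-1}\,b\,y_i\cdots y_{n-2}$ to $y_0\cdots y_{i-1}\,(1-b)\,y_i\cdots y_{n-2}$, where $b=1$ if the number of zeros among $y_0,\dots,y_{i-1}$ is odd and $b=0$ otherwise. The dimension of a loop is "trivial"; that of a non-loop edge joining vertices differing in coordinate $i$ is $i$. A graph morphism $g:T_m\to T_n$ is dimension-preserving if any two edges of $T_m$ with equal dimension are sent to edges with equal dimension. A face of $T_n$ is a function $f:\{0,\dots,n-1\}\to\{0,1,\star\}$; its dimension is the number of $i$ with $f(i)=\star$. -}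

module Defs where

open import Data.Bool using (Bool; true; false; not; _xor_)
open import Data.Nat using (ℕ; zero; suc; _≤_)
open import Data.Fin using (Fin; zero; suc)
open import Data.Vec using (Vec; []; _∷_; insertAt)
open import Data.Maybe using (Maybe; just; nothing)
open import Data.Product using (Σ; ∃; _×_; _,_)
open import Relation.Binary.PropositionalEquality using (_≡_; subst)

-- Vertices of T_n : {0,1}^n, with false = 0 and true = 1.
Vert : ℕ → Set
Vert n = Vec Bool n

-- parity y i = 1 iff the number of zeros among y_0 … y_{i-1} is odd.
parity : ∀ {n} → Vec Bool n → Fin (suc n) → Bool
parity y        zero    = false
parity (x ∷ y)  (suc i) = not x xor parity y i

data Edge : {n : ℕ} → Vert n → Vert n → Set where
  loop : ∀ {n} (v : Vert n) → Edge v v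
  step : ∀ {n} (i : Fin (suc n)) (y : Vert n) →
         Edge (insertAt y i (parity y i)) (insertAt y i (not (parity y i)))

dimE : ∀ {n} {s t : Vert n} → Edge s t → Maybe (Fin n)
dimE (loop _)   = nothing
dimE (step i y) = just i

IsGraphMor : ∀ {m n} → (Vert m → Vert n) → Set
IsGraphMor {m} {n} f = ∀ (s t : Vert m) → Edge s t → Edge (f s) (f t)

IsDimPres : ∀ {m n} → (Vert m → Vert n) → Set
IsDimPres {m} {n} f =
  ∀ (s t s' t' : Vert m) (e : Edge s t) (e' : Edge s' t') → dimE e ≡ dimE e' →
  (d : Edge (f s) (f t)) (d' : Edge (f s') (f t')) → dimE d ≡ dimE d'

record DPMor (m n : ℕ) : Set where
  field
    fun  : Vert m → Vert n
    mor  : IsGraphMor fun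
    dpre : IsDimPres fun
open DPMor public

Surjective : ∀ {m n} → (Vert m → Vert n) → Set
Surjective {m} {n} f = ∀ (w : Vert n) → ∃ λ (v : Vert m) → f v ≡ w

Injective : ∀ {m n} → (Vert m → Vert n) → Set
Injective {m} {n} f = ∀ (v v' : Vert m) → f v ≡ f v' → v ≡ v'

record Fact (m n : ℕ) : Set where
  field
    k     : ℕ
    g     : DPMor m k
    h     : DPMor k n
    gSurj : Surjective (fun g)
    hInj  : Injective (fun h)
open Fact public

composite : ∀ {m n} → Fact m n → Vert m → Vert n
composite F v = fun (h F) (fun (g F) v)

FactEq : ∀ {m n} → Fact m n → Fact m n → Set
FactEq F F' =
  Σ (k F ≡ k F') λ e →
    (∀ v → subst Vert e (fun (g F) v) ≡ fun (g F') v) ×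
    (∀ w → fun (h F) w ≡ fun (h F') (subst Vert e w))

data Tri : Set where
  t0 t1 ⋆ : Tri

Face : ℕ → Set
Face n = Vec Tri n

faceDim : ∀ {n} → Face n → ℕ
faceDim []        = 0
faceDim (⋆ ∷ φ)   = suc (faceDim φ)
faceDim (t0 ∷ φ)  = faceDim φ
faceDim (t1 ∷ φ)  = faceDim φ

-- Every dimension-preserving morphism f : T_m → T_n is the projection onto the first k
-- coordinates followed by the inclusion of the k-dimensional face spanned by f(0⋯0) and f(1⋯1).
-- This goes by induction on n, looking at the first coordinate of f. An edge inside a subcube
-- with fixed first coordinate cannot change it: its mirror edge in the other subcube has the same
-- dimension and would change it too, which the orientation of the dimension-0 edges between the
-- two subcubes rules out. So the first coordinate of f is either constant or the first source
-- coordinate up to a flip, and the remaining coordinates form a smaller morphism of the same kind.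
-- The normal form is itself a surjection followed by an injection; conversely a surjective normal
-- form projects onto the full face and an injective one discards no coordinate, which pins down
-- every such factorisation.
module Submission where

open import Data.Bool using (Bool; true; false; not; _xor_)
open import Data.Bool.Properties
  using (_≟_; not-involutive; not-¬; xor-assoc; xor-comm; xor-same; xor-identityʳ;
         not-distribˡ-xor; not-distribʳ-xor; xor-annihilates-not)
open import Data.Empty using (⊥-elim)
open import Data.Fin using (Fin; zero; suc; lift)
open import Data.Fin.Properties using (suc-injective)
open import Data.Maybe using (Maybe; just; nothing; map; _>>=_)
open import Data.Maybe.Properties using (map-injective; map-∘)
open import Data.Nat using (ℕ; zero; suc; _≤_; z≤n; s≤s)
open import Data.Product using (Σ; ∃; _×_; _,_; proj₁; proj₂)
open import Data.Sum using (_⊎_; inj₁; inj₂; [_,_])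
open import Data.Vec using (Vec; []; _∷_; head; tail; replicate; zipWith; insertAt; padRight)
open import Data.Vec.Properties using (∷-injectiveˡ; ∷-injectiveʳ)
open import Function using (_∘_)
open import Relation.Binary.PropositionalEquality
  using (_≡_; _≢_; _≗_; refl; sym; trans; cong; cong₂; subst; subst₂; module ≡-Reasoning)
open import Relation.Nullary using (Dec; yes; no)

open import Defs

variable
  l m n : ℕ
  r s t : Bool

xor-swap : ∀ a b c → a xor (b xor c) ≡ b xor (a xor c)
xor-swap a b c =
  trans (sym (xor-assoc a b c)) (trans (cong (_xor c) (xor-comm a b)) (xor-assoc b a c))

xor-rotate : ∀ a b c → (a xor b) xor c ≡ b xor (a xor c)
xor-rotate a b c = trans (xor-assoc a b c) (xor-swap a b c)

xor-involutiveˡ : ∀ d x → d xor (d xor x) ≡ x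
xor-involutiveˡ false x = refl
xor-involutiveˡ true  x = not-involutive x

not-not-xor-cancel : ∀ s t → not (not (s xor t)) xor t ≡ s
not-not-xor-cancel false false = refl
not-not-xor-cancel false true  = refl
not-not-xor-cancel true  false = refl
not-not-xor-cancel true  true  = refl

false≢true : false ≢ true
false≢true ()

not-invariant⇒constant : ∀ {A : Set} (h : Bool → A) s → h s ≡ h (not s) → ∀ x y → h x ≡ h y
not-invariant⇒constant h s     eq false false = refl
not-invariant⇒constant h s     eq true  true  = refl
not-invariant⇒constant h false eq false true  = eq
not-invariant⇒constant h true  eq false true  = sym eq
not-invariant⇒constant h false eq true  false = sym eq
not-invariant⇒constant h true  eq true  false = eq

xor-characterisation : ∀ (h : Bool → Bool) s → h s ≡ t → h (not s) ≡ not t →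
  ∀ x → h x ≡ x xor (s xor t)
xor-characterisation     h false hs hns false = hs
xor-characterisation     h true  hs hns false = hns
xor-characterisation     h false hs hns true  = hns
xor-characterisation {t} h true  hs hns true  = trans hs (sym (not-involutive t))

≡-head∷tail : ∀ {c} (u : Vert (suc n)) → head u ≡ c → u ≡ c ∷ tail u
≡-head∷tail (x ∷ u) refl = refl

vert0≡[] : (u : Vert 0) → u ≡ []
vert0≡[] [] = refl

zeros ones : Vert n
zeros = replicate _ false
ones  = replicate _ true

dim : Vert n → Vert n → Maybe (Fin n)
dim []          []          = nothing
dim (false ∷ a) (false ∷ b) = map suc (dim a b)
dim (true  ∷ a) (true  ∷ b) = map suc (dim a b)
dim (false ∷ a) (true  ∷ b) = just zero
dim (true  ∷ a) (false ∷ b) = just zero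

dim-refl : (a : Vert n) → dim a a ≡ nothing
dim-refl []          = refl
dim-refl (false ∷ a) = cong (map suc) (dim-refl a)
dim-refl (true  ∷ a) = cong (map suc) (dim-refl a)

dim-sym : (a b : Vert n) → dim a b ≡ dim b a
dim-sym []          []          = refl
dim-sym (false ∷ a) (false ∷ b) = cong (map suc) (dim-sym a b)
dim-sym (true  ∷ a) (true  ∷ b) = cong (map suc) (dim-sym a b)
dim-sym (false ∷ a) (true  ∷ b) = refl
dim-sym (true  ∷ a) (false ∷ b) = refl

dim-∷ : ∀ x (a b : Vert n) → dim (x ∷ a) (x ∷ b) ≡ map suc (dim a b)
dim-∷ false a b = refl
dim-∷ true  a b = refl

heads≢⇒dim≡just-zero : (u w : Vert (suc n)) → head u ≢ head w → dim u w ≡ just zero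
heads≢⇒dim≡just-zero (false ∷ u) (false ∷ w) ne = ⊥-elim (ne refl)
heads≢⇒dim≡just-zero (true  ∷ u) (true  ∷ w) ne = ⊥-elim (ne refl)
heads≢⇒dim≡just-zero (false ∷ u) (true  ∷ w) ne = refl
heads≢⇒dim≡just-zero (true  ∷ u) (false ∷ w) ne = refl

dim≡just-zero⇒heads≢ : (u w : Vert (suc n)) → dim u w ≡ just zero → head u ≢ head w
dim≡just-zero⇒heads≢ (x ∷ u) (.x ∷ w) eq refl =
  map-suc≢just-zero (dim u w) (trans (sym (dim-∷ x u w)) eq)
  where
    map-suc≢just-zero : (M : Maybe (Fin n)) → _≢_ {A = Maybe (Fin (suc n))} (map suc M) (just zero)
    map-suc≢just-zero nothing  ()
    map-suc≢just-zero (just i) ()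

dim-insertAt : ∀ (i : Fin (suc n)) y c → dim (insertAt y i c) (insertAt y i (not c)) ≡ just i
dim-insertAt zero    y       c = heads≢⇒dim≡just-zero (c ∷ y) (not c ∷ y) (not-¬ refl)
dim-insertAt (suc i) (x ∷ y) c = trans (dim-∷ x _ _) (cong (map suc) (dim-insertAt i y c))

dimE≡dim : {a b : Vert n} (e : Edge a b) → dimE e ≡ dim a b
dimE≡dim (loop v)   = sym (dim-refl v)
dimE≡dim (step i y) = sym (dim-insertAt i y (parity y i))

-- Arrow s a b: a and b differ at a single coordinate i, where a carries parity y i xor s
-- (arrow-insertAt). So Arrow false is the edge relation of T_n without loops and Arrow true its
-- reverse. Both are needed because a subcube with fixed first coordinate x is a copy of T_(n-1)
-- or of its reverse, according to x.
data Arrow : Bool → Vert n → Vert n → Set where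
  here  : ∀ s (a : Vert n) → Arrow s (s ∷ a) (not s ∷ a)
  there : ∀ {a b : Vert n} x → Arrow (not x xor s) a b → Arrow s (x ∷ a) (x ∷ b)

reverse : {a b : Vert n} → Arrow s a b → Arrow (not s) b a
reverse (here s a) =
  subst (λ c → Arrow (not s) (not s ∷ a) (c ∷ a)) (not-involutive s) (here (not s) a)
reverse {s = s} (there x e) =
  there x (subst (λ r → Arrow r _ _) (not-distribʳ-xor (not x) s) (reverse e))

arrow-insertAt : ∀ s (i : Fin (suc n)) y →
  Arrow s (insertAt y i (parity y i xor s)) (insertAt y i (not (parity y i xor s)))
arrow-insertAt s zero    y       = here s y
arrow-insertAt s (suc i) (x ∷ y) =
  there x (subst (λ c → Arrow (not x xor s) (insertAt y i c) (insertAt y i (not c)))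
                 (sym (xor-rotate (not x) (parity y i) s))
                 (arrow-insertAt (not x xor s) i y))

arrow⇒insertAt : {a b : Vert (suc n)} → Arrow s a b →
  Σ (Fin (suc n)) λ i → Σ (Vert n) λ y →
    a ≡ insertAt y i (parity y i xor s) × b ≡ insertAt y i (not (parity y i xor s))
arrow⇒insertAt (here s a) = zero , a , refl , refl
arrow⇒insertAt {n = suc n} {s = s} (there x e) with arrow⇒insertAt e
... | i , y , refl , refl =
  suc i , x ∷ y , cong (x ∷_) (cong (insertAt y i) eq) , cong (x ∷_) (cong (insertAt y i ∘ not) eq)
  where
    eq : parity y i xor (not x xor s) ≡ (not x xor parity y i) xor s
    eq = sym (xor-rotate (not x) (parity y i) s)

edge⇒arrow : {a b : Vert n} → Edge a b → a ≡ b ⊎ Arrow false a b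
edge⇒arrow (loop v)   = inj₁ refl
edge⇒arrow (step i y) =
  inj₂ (subst (λ c → Arrow false (insertAt y i c) (insertAt y i (not c)))
              (xor-identityʳ (parity y i)) (arrow-insertAt false i y))

arrow⇒edge : {a b : Vert n} → Arrow false a b → Edge a b
arrow⇒edge {n = suc n} e with arrow⇒insertAt e
... | i , y , refl , refl =
  subst (λ c → Edge (insertAt y i c) (insertAt y i (not c))) (sym (xor-identityʳ (parity y i)))
        (step i y)

Hom : Bool → Bool → (Vert m → Vert n) → Set
Hom s t f = ∀ {a b} → Arrow s a b → f a ≡ f b ⊎ Arrow t (f a) (f b)

DimPres : Bool → (Vert m → Vert n) → Set
DimPres s f = ∀ {a b a′ b′} → Arrow s a b → Arrow s a′ b′ → dim a b ≡ dim a′ b′ →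
  dim (f a) (f b) ≡ dim (f a′) (f b′)

DimFactors : (Vert m → Vert n) → Set
DimFactors {m} {n} f =
  Σ (Maybe (Fin m) → Maybe (Fin n)) λ G → ∀ a b → dim (f a) (f b) ≡ G (dim a b)

hom-∘ : {f : Vert l → Vert m} {f′ : Vert m → Vert n} →
  Hom r s f → Hom s t f′ → Hom r t (f′ ∘ f)
hom-∘ {f′ = f′} hom hom′ e = [ inj₁ ∘ cong f′ , hom′ ] (hom e)

dimFactors-∘ : {f : Vert l → Vert m} {f′ : Vert m → Vert n} →
  DimFactors f → DimFactors f′ → DimFactors (f′ ∘ f)
dimFactors-∘ {f = f} (G , dimG) (G′ , dimG′) =
  G′ ∘ G , λ a b → trans (dimG′ (f a) (f b)) (cong G′ (dimG a b))

dpmor-hom : (f : DPMor m n) → Hom false false (fun f)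
dpmor-hom f e = edge⇒arrow (mor f _ _ (arrow⇒edge e))

dpmor-dimPres : (f : DPMor m n) → DimPres false (fun f)
dpmor-dimPres f {a} {b} {a′} {b′} e e′ eq = begin
  dim (fun f a) (fun f b)   ≡⟨ sym (dimE≡dim d) ⟩
  dimE d                    ≡⟨ dpre f a b a′ b′ (arrow⇒edge e) (arrow⇒edge e′) same-dim d d′ ⟩
  dimE d′                   ≡⟨ dimE≡dim d′ ⟩
  dim (fun f a′) (fun f b′) ∎
  where
    open ≡-Reasoning
    d  = mor f a b (arrow⇒edge e)
    d′ = mor f a′ b′ (arrow⇒edge e′)
    same-dim = trans (dimE≡dim (arrow⇒edge e)) (trans eq (sym (dimE≡dim (arrow⇒edge e′))))

mkDPMor : (f : Vert m → Vert n) → Hom false false f → DimFactors f → DPMor m n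
mkDPMor f hom (G , dimG) = record { fun = f ; mor = image-edge ; dpre = image-dims }
  where
    image-edge : IsGraphMor f
    image-edge a b e with edge⇒arrow e
    ... | inj₁ refl = loop (f a)
    ... | inj₂ e′ with hom e′
    ... | inj₁ eq = subst (Edge (f a)) eq (loop (f a))
    ... | inj₂ e″ = arrow⇒edge e″
    image-dims : IsDimPres f
    image-dims a b a′ b′ e e′ eq d d′ = begin
      dimE d            ≡⟨ dimE≡dim d ⟩
      dim (f a) (f b)   ≡⟨ dimG a b ⟩
      G (dim a b)       ≡⟨ cong G (trans (sym (dimE≡dim e)) (trans eq (dimE≡dim e′))) ⟩
      G (dim a′ b′)     ≡⟨ sym (dimG a′ b′) ⟩
      dim (f a′) (f b′) ≡⟨ sym (dimE≡dim d′) ⟩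
      dimE d′           ∎
      where open ≡-Reasoning

arrow-flips-head : {u w : Vert (suc n)} → Arrow t u w → head u ≢ head w →
  head u ≡ t × head w ≡ not t × tail u ≡ tail w
arrow-flips-head (here t a)  ne = refl , refl , refl
arrow-flips-head (there x e) ne = ⊥-elim (ne refl)

arrow-keeps-head : {u w : Vert (suc n)} → Arrow t u w → head u ≡ head w →
  Arrow (not (head u) xor t) (tail u) (tail w)
arrow-keeps-head (here t a)  eq = ⊥-elim (not-¬ refl eq)
arrow-keeps-head (there x e) eq = e

restrict-hom : ∀ x {f : Vert (suc m) → Vert n} → Hom s t f → Hom (not x xor s) t (f ∘ (x ∷_))
restrict-hom x hom e = hom (there x e)

restrict-dimPres : ∀ x {f : Vert (suc m) → Vert n} →
  DimPres s f → DimPres (not x xor s) (f ∘ (x ∷_))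
restrict-dimPres x dp {a} {b} {a′} {b′} e e′ eq = dp (there x e) (there x e′)
  (trans (dim-∷ x a b) (trans (cong (map suc) eq) (sym (dim-∷ x a′ b′))))

tail-hom : ∀ {c} {f : Vert m → Vert (suc n)} {R : Vert m → Vert n} →
  (∀ v → f v ≡ c ∷ R v) → Hom s t f → Hom s (not c xor t) R
tail-hom f≗ hom {a} {b} e with hom e
... | inj₁ eq = inj₁ (∷-injectiveʳ (trans (sym (f≗ a)) (trans eq (f≗ b))))
... | inj₂ e′ = inj₂ (arrow-keeps-head (subst₂ (Arrow _) (f≗ a) (f≗ b) e′) refl)

tail-dimPres : ∀ {c} {f : Vert m → Vert (suc n)} {R : Vert m → Vert n} →
  (∀ v → f v ≡ c ∷ R v) → DimPres s f → DimPres s R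
tail-dimPres {c = c} {f} {R} f≗ dp {a} {b} {a′} {b′} e e′ eq =
  map-injective suc-injective (begin
    map suc (dim (R a) (R b))   ≡⟨ sym (dim-∷ c (R a) (R b)) ⟩
    dim (c ∷ R a) (c ∷ R b)     ≡⟨ sym (cong₂ dim (f≗ a) (f≗ b)) ⟩
    dim (f a) (f b)             ≡⟨ dp e e′ eq ⟩
    dim (f a′) (f b′)           ≡⟨ cong₂ dim (f≗ a′) (f≗ b′) ⟩
    dim (c ∷ R a′) (c ∷ R b′)   ≡⟨ dim-∷ c (R a′) (R b′) ⟩
    map suc (dim (R a′) (R b′)) ∎)
  where open ≡-Reasoning

connected : ∀ {A : Set} s (G : Vert m → A) → (∀ {a b} → Arrow s a b → G a ≡ G b) →
  ∀ v w → G v ≡ G w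
connected s G inv []      []      = refl
connected s G inv (x ∷ v) (y ∷ w) =
  trans (connected (not x xor s) (G ∘ (x ∷_)) (λ e → inv (there x e)) v w)
        (not-invariant⇒constant (λ z → G (z ∷ w)) s (inv (here s w)) x y)

module HeadAnalysis {s t} {f : Vert (suc m) → Vert (suc n)} (hom : Hom s t f) where

  H : Vert (suc m) → Bool
  H v = head (f v)

  image-flips-head : ∀ {a b} → Arrow s a b → H a ≢ H b →
    H a ≡ t × H b ≡ not t × tail (f a) ≡ tail (f b)
  image-flips-head e ne with hom e
  ... | inj₁ eq = ⊥-elim (ne (cong head eq))
  ... | inj₂ e′ = arrow-flips-head e′ ne

  split-shape : ∀ {c} y → H (y ∷ c) ≢ H (not y ∷ c) →
    ∀ x → f (x ∷ c) ≡ (x xor (s xor t)) ∷ tail (f (true ∷ c))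
  split-shape {c} y ne x = trans
    (≡-head∷tail (f (x ∷ c))
      (xor-characterisation (λ z → H (z ∷ c)) s (proj₁ flip) (proj₁ (proj₂ flip)) x))
    (cong (_ ∷_) (not-invariant⇒constant (λ z → tail (f (z ∷ c))) s (proj₂ (proj₂ flip)) x true))
    where
      flip = image-flips-head (here s c)
        (λ eq → ne (not-invariant⇒constant (λ z → H (z ∷ c)) s eq y (not y)))

  module _ (dp : DimPres s f) where

    -- An arrow inside a subcube cannot flip the head: its mirror image in the other subcube has
    -- the same dimension, so it would flip the head as well, and split-shape then gives the two
    -- endpoints the same head.
    head-invariant : ∀ x {a b} → Arrow (not x xor s) a b → H (x ∷ a) ≡ H (x ∷ b)
    head-invariant x {a} {b} e with H (x ∷ a) ≟ H (x ∷ b)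
    ... | yes eq = eq
    ... | no  ne = ⊥-elim (ne (trans (cong head (split-shape x a-splits x))
                                     (sym (cong head (split-shape x b-splits x)))))
      where
        mirror : Arrow s (not x ∷ b) (not x ∷ a)
        mirror = there (not x) (subst (λ r → Arrow r b a) (not-distribˡ-xor (not x) s) (reverse e))
        same-dim : dim (x ∷ a) (x ∷ b) ≡ dim (not x ∷ b) (not x ∷ a)
        same-dim =
          trans (dim-∷ x a b) (trans (cong (map suc) (dim-sym a b)) (sym (dim-∷ (not x) b a)))
        mirror-flips : H (not x ∷ b) ≢ H (not x ∷ a)
        mirror-flips = dim≡just-zero⇒heads≢ (f _) (f _)
          (trans (sym (dp (there x e) mirror same-dim)) (heads≢⇒dim≡just-zero (f _) (f _) ne))
        flip  = image-flips-head (there x e) ne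
        flip′ = image-flips-head mirror mirror-flips
        a-splits : H (x ∷ a) ≢ H (not x ∷ a)
        a-splits eq = not-¬ refl (trans (sym (proj₁ flip)) (trans eq (proj₁ (proj₂ flip′))))
        b-splits : H (x ∷ b) ≢ H (not x ∷ b)
        b-splits eq = not-¬ refl (trans (sym (proj₁ flip′)) (trans (sym eq) (proj₁ (proj₂ flip))))

    head-on-subcube : ∀ x v w → H (x ∷ v) ≡ H (x ∷ w)
    head-on-subcube x = connected (not x xor s) (λ v → H (x ∷ v)) (head-invariant x)

data HeadShape (s t : Bool) : {m n : ℕ} → (Vert m → Vert (suc n)) → Set where
  constant : ∀ {m n} {f : Vert m → Vert (suc n)} c →
    (∀ v → f v ≡ c ∷ tail (f v)) → HeadShape s t f
  split    : ∀ {m n} {f : Vert (suc m) → Vert (suc n)} →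
    (∀ x v → f (x ∷ v) ≡ (x xor (s xor t)) ∷ tail (f (true ∷ v))) → HeadShape s t f

headShape : {f : Vert m → Vert (suc n)} → Hom s t f → DimPres s f → HeadShape s t f
headShape {zero} {f = f} hom dp = constant (head (f [])) λ { [] → ≡-head∷tail (f []) refl }
headShape {suc m} {s = s} {t} {f} hom dp = shape (H (false ∷ zeros) ≟ H (true ∷ zeros))
  where
    open HeadAnalysis hom
    shape : Dec (H (false ∷ zeros) ≡ H (true ∷ zeros)) → HeadShape s t f
    shape (yes eq) = constant (H (false ∷ zeros)) λ { (x ∷ v) → ≡-head∷tail (f (x ∷ v))
      (trans (head-on-subcube dp x v zeros)
             (not-invariant⇒constant (λ z → H (z ∷ zeros)) false eq x false)) }
    shape (no ne) = split λ x v → split-shape false (split-at v) x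
      where
        split-at : ∀ v → H (false ∷ v) ≢ H (true ∷ v)
        split-at v eq =
          ne (trans (head-on-subcube dp false zeros v) (trans eq (head-on-subcube dp true v zeros)))

-- The first j coordinates, padded with zeros when j exceeds the dimension m of the source.
project : ∀ j → Vert m → Vert j
project zero    v       = []
project (suc j) []      = false ∷ project j []
project (suc j) (x ∷ v) = x ∷ project j v

project-hom : ∀ j → Hom s s (project {m} j)
project-hom zero    e           = inj₁ refl
project-hom (suc j) (here s a)  = inj₂ (here s _)
project-hom (suc j) (there x e) = [ inj₁ ∘ cong (x ∷_) , inj₂ ∘ there x ] (project-hom j e)

below : ∀ j → Fin m → Maybe (Fin j)
below zero    i       = nothing
below (suc j) zero    = just zero
below (suc j) (suc i) = map suc (below j i)

project-dimFactors : ∀ j → DimFactors (project {m} j)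
project-dimFactors j = (_>>= below j) , project-dim j
  where
    map-suc-bind : ∀ {j} (M : Maybe (Fin m)) →
      map suc (M >>= below j) ≡ (map suc M >>= below (suc j))
    map-suc-bind nothing  = refl
    map-suc-bind (just i) = refl
    project-dim : ∀ j (a b : Vert m) → dim (project j a) (project j b) ≡ (dim a b >>= below j)
    project-dim zero a b with dim a b
    ... | nothing = refl
    ... | just i  = refl
    project-dim (suc j) []          []          = cong (map suc) (dim-refl (project j []))
    project-dim (suc j) (false ∷ a) (false ∷ b) =
      trans (cong (map suc) (project-dim j a b)) (map-suc-bind (dim a b))
    project-dim (suc j) (true  ∷ a) (true  ∷ b) =
      trans (cong (map suc) (project-dim j a b)) (map-suc-bind (dim a b))
    project-dim (suc j) (false ∷ a) (true  ∷ b) = refl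
    project-dim (suc j) (true  ∷ a) (false ∷ b) = refl

project-zeros : ∀ j → project j (zeros {m}) ≡ zeros
project-zeros         zero    = refl
project-zeros {zero}  (suc j) = cong (false ∷_) (project-zeros j)
project-zeros {suc m} (suc j) = cong (false ∷_) (project-zeros j)

project-ones : ∀ {j} → j ≤ m → project j (ones {m}) ≡ ones
project-ones z≤n       = refl
project-ones (s≤s j≤m) = cong (true ∷_) (project-ones j≤m)

project-padRight : ∀ {j} (le : j ≤ m) (w : Vert j) → project j (padRight le false w) ≡ w
project-padRight z≤n      []      = refl
project-padRight (s≤s le) (x ∷ w) = cong (x ∷_) (project-padRight le w)

project-injective⇒≡ : ∀ {i j} → i ≤ j → Injective (project {j} i) → i ≡ j
project-injective⇒≡ {j = zero}  z≤n inj = refl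
project-injective⇒≡ {j = suc j} z≤n inj = ⊥-elim (false≢true (∷-injectiveˡ (inj zeros ones refl)))
project-injective⇒≡ (s≤s le) inj = cong suc (project-injective⇒≡ le λ a b eq →
  ∷-injectiveʳ (inj (false ∷ a) (false ∷ b) (cong (false ∷_) eq)))

-- A free coordinate is flipped by the parity d of the zeros fixed since the previous free
-- coordinate; this is what makes embed d φ a graph morphism (embed-arrow).
embed : Bool → (φ : Face n) → Vert (faceDim φ) → Vert n
embed d []       v       = []
embed d (t0 ∷ φ) v       = false ∷ embed (not d) φ v
embed d (t1 ∷ φ) v       = true ∷ embed d φ v
embed d (⋆ ∷ φ)  (x ∷ v) = (d xor x) ∷ embed false φ v

embed-arrow : ∀ d (φ : Face n) {a b} → Arrow s a b → Arrow (d xor s) (embed d φ a) (embed d φ b)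
embed-arrow d []       ()
embed-arrow {s = s} d (t0 ∷ φ) e =
  there false (subst (λ r → Arrow r _ _) (sym (not-distribˡ-xor d s)) (embed-arrow (not d) φ e))
embed-arrow d (t1 ∷ φ) e = there true (embed-arrow d φ e)
embed-arrow d (⋆ ∷ φ) (here s a) =
  subst (λ c → Arrow (d xor s) ((d xor s) ∷ _) (c ∷ _)) (not-distribʳ-xor d s) (here (d xor s) _)
embed-arrow {s = s} d (⋆ ∷ φ) (there x e) =
  there (d xor x) (subst (λ r → Arrow r _ _) (sym (polarity d)) (embed-arrow false φ e))
  where
    polarity : ∀ d → not (d xor x) xor (d xor s) ≡ not x xor s
    polarity false = refl
    polarity true  = xor-annihilates-not (not x) s

embed-hom : (φ : Face n) → Hom false false (embed false φ)
embed-hom φ e = inj₂ (embed-arrow false φ e)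

embed-injective : ∀ d (φ : Face n) {a b} → embed d φ a ≡ embed d φ b → a ≡ b
embed-injective d []       {[]}    {[]}    eq = refl
embed-injective d (t0 ∷ φ)                 eq = embed-injective (not d) φ (∷-injectiveʳ eq)
embed-injective d (t1 ∷ φ)                 eq = embed-injective d φ (∷-injectiveʳ eq)
embed-injective d (⋆ ∷ φ)  {x ∷ a} {y ∷ b} eq = cong₂ _∷_
  (trans (sym (xor-involutiveˡ d x)) (trans (cong (d xor_) (∷-injectiveˡ eq)) (xor-involutiveˡ d y)))
  (embed-injective false φ (∷-injectiveʳ eq))

embed-surjective⇒full : ∀ d (ψ : Face n) → (∀ w → ∃ λ u → embed d ψ u ≡ w) → ψ ≡ replicate n ⋆
embed-surjective⇒full d []       surj = refl
embed-surjective⇒full d (t0 ∷ ψ) surj = ⊥-elim (false≢true (∷-injectiveˡ (proj₂ (surj ones))))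
embed-surjective⇒full d (t1 ∷ ψ) surj =
  ⊥-elim (false≢true (sym (∷-injectiveˡ (proj₂ (surj zeros)))))
embed-surjective⇒full d (⋆ ∷ ψ)  surj =
  cong (⋆ ∷_) (embed-surjective⇒full false ψ λ w → tail-preimage (surj (false ∷ w)))
  where
    tail-preimage : ∀ {w} → ∃ (λ u → embed d (⋆ ∷ ψ) u ≡ false ∷ w) → ∃ λ u → embed false ψ u ≡ w
    tail-preimage (x ∷ u , eq) = u , ∷-injectiveʳ eq

starPos : (φ : Face n) → Fin (faceDim φ) → Fin n
starPos []       ()
starPos (t0 ∷ φ) = suc ∘ starPos φ
starPos (t1 ∷ φ) = suc ∘ starPos φ
starPos (⋆ ∷ φ)  = lift 1 (starPos φ)

embed-dimFactors : ∀ d (φ : Face n) → DimFactors (embed d φ)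
embed-dimFactors d φ = map (starPos φ) , embed-dim d φ
  where
    dim-xor-heads : ∀ d x y (u w : Vert n) →
      dim ((d xor x) ∷ u) ((d xor y) ∷ w) ≡ dim (x ∷ u) (y ∷ w)
    dim-xor-heads false x     y     u w = refl
    dim-xor-heads true  false false u w = refl
    dim-xor-heads true  true  true  u w = refl
    dim-xor-heads true  false true  u w = refl
    dim-xor-heads true  true  false u w = refl
    map-suc-lift : ∀ {σ : Fin m → Fin n} M → map suc (map σ M) ≡ map (lift 1 σ) (map suc M)
    map-suc-lift nothing  = refl
    map-suc-lift (just i) = refl
    dim-∷-lift : ∀ x y {σ : Fin m → Fin n} {a b u w} → dim u w ≡ map σ (dim a b) →
      dim (x ∷ u) (y ∷ w) ≡ map (lift 1 σ) (dim (x ∷ a) (y ∷ b))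
    dim-∷-lift false false {a = a} {b} eq = trans (cong (map suc) eq) (map-suc-lift (dim a b))
    dim-∷-lift true  true  {a = a} {b} eq = trans (cong (map suc) eq) (map-suc-lift (dim a b))
    dim-∷-lift false true  eq = refl
    dim-∷-lift true  false eq = refl
    embed-dim : ∀ d (φ : Face n) a b →
      dim (embed d φ a) (embed d φ b) ≡ map (starPos φ) (dim a b)
    embed-dim d []       []      []      = refl
    embed-dim d (t0 ∷ φ) a       b       =
      trans (cong (map suc) (embed-dim (not d) φ a b)) (sym (map-∘ (dim a b)))
    embed-dim d (t1 ∷ φ) a       b       =
      trans (cong (map suc) (embed-dim d φ a b)) (sym (map-∘ (dim a b)))
    embed-dim d (⋆ ∷ φ)  (x ∷ a) (y ∷ b) =
      trans (dim-xor-heads d x y _ _) (dim-∷-lift x y (embed-dim false φ a b))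

canonical : (φ : Face n) → Vert m → Vert n
canonical φ = embed false φ ∘ project (faceDim φ)

canonical-full : ∀ j (v : Vert m) → canonical (replicate j ⋆) v ≡ project j v
canonical-full zero    v       = refl
canonical-full (suc j) []      = cong (false ∷_) (canonical-full j [])
canonical-full (suc j) (x ∷ v) = cong (x ∷_) (canonical-full j v)

faceDim-full : ∀ j → faceDim (replicate j ⋆) ≡ j
faceDim-full zero    = refl
faceDim-full (suc j) = cong suc (faceDim-full j)

projectMor : ∀ j → DPMor m j
projectMor j = mkDPMor (project j) (project-hom j) (project-dimFactors j)

embedMor : (φ : Face n) → DPMor (faceDim φ) n
embedMor φ = mkDPMor (embed false φ) (embed-hom φ) (embed-dimFactors false φ)

canonicalMor : (φ : Face n) → DPMor m n
canonicalMor φ = mkDPMor (canonical φ)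
  (hom-∘ {f = project (faceDim φ)} (project-hom (faceDim φ)) (embed-hom φ))
  (dimFactors-∘ {f = project (faceDim φ)} {embed false φ}
    (project-dimFactors (faceDim φ)) (embed-dimFactors false φ))

spanBit : Bool → Bool → Tri
spanBit false false = t0
spanBit true  true  = t1
spanBit _     _     = ⋆

faceOf : (Vert m → Vert n) → Face n
faceOf f = zipWith spanBit (f zeros) (f ones)

faceOf-cong : {f f′ : Vert m → Vert n} → f ≗ f′ → faceOf f ≡ faceOf f′
faceOf-cong eq = cong₂ (zipWith spanBit) (eq zeros) (eq ones)

faceOf-∘project : ∀ {j} (f : Vert j → Vert n) → j ≤ m → faceOf (f ∘ project {m} j) ≡ faceOf f
faceOf-∘project f j≤m =
  cong₂ (λ u w → zipWith spanBit (f u) (f w)) (project-zeros _) (project-ones j≤m)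

faceOf-embed : ∀ d (φ : Face n) → faceOf (embed d φ) ≡ φ
faceOf-embed d     []       = refl
faceOf-embed d     (t0 ∷ φ) = cong (t0 ∷_) (faceOf-embed (not d) φ)
faceOf-embed d     (t1 ∷ φ) = cong (t1 ∷_) (faceOf-embed d φ)
faceOf-embed false (⋆ ∷ φ)  = cong (⋆ ∷_) (faceOf-embed false φ)
faceOf-embed true  (⋆ ∷ φ)  = cong (⋆ ∷_) (faceOf-embed false φ)

faceOf-canonical : (φ : Face n) → faceDim φ ≤ m → faceOf (canonical {m = m} φ) ≡ φ
faceOf-canonical φ le = trans (faceOf-∘project (embed false φ) le) (faceOf-embed false φ)

NormalForm : Bool → Face n → (Vert m → Vert n) → Set
NormalForm {m = m} d φ f = faceDim φ ≤ m × (∀ v → f v ≡ embed d φ (project (faceDim φ) v))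

normalForm-into-point : ∀ d (f : Vert m → Vert 0) → NormalForm d (faceOf f) f
normalForm-into-point d f = into-point (faceOf f)
  where
    into-point : (φ : Face 0) → NormalForm d φ f
    into-point [] = z≤n , λ v → vert0≡[] (f v)

normalForm-cons : ∀ {d} c {f : Vert m → Vert (suc n)} {R : Vert m → Vert n} →
  (∀ v → f v ≡ c ∷ R v) → NormalForm (not c xor d) (faceOf R) R → NormalForm d (faceOf f) f
normalForm-cons {d = d} c {f} {R} f≗ =
  subst (λ φ → NormalForm d φ f) (sym (faceOf-cong f≗)) ∘ cons c f≗
  where
    cons : ∀ c → (∀ v → f v ≡ c ∷ R v) → NormalForm (not c xor d) (faceOf R) R →
      NormalForm d (spanBit c c ∷ faceOf R) f
    cons false f≗ (le , R≗) = le , λ v → trans (f≗ v) (cong (false ∷_) (R≗ v))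
    cons true  f≗ (le , R≗) = le , λ v → trans (f≗ v) (cong (true ∷_) (R≗ v))

normalForm-⋆ : ∀ {d} {f : Vert (suc m) → Vert (suc n)} {R : Vert m → Vert n} →
  (∀ x v → f (x ∷ v) ≡ (x xor d) ∷ R v) → NormalForm false (faceOf R) R →
  NormalForm d (faceOf f) f
normalForm-⋆ {d = d} {f} {R} f≗ (le , R≗) = subst (λ φ → NormalForm d φ f) (sym face)
  (s≤s le , λ { (x ∷ v) → trans (f≗ x v) (cong₂ _∷_ (xor-comm x d) (R≗ v)) })
  where
    spanBit-not : ∀ d → spanBit d (not d) ≡ ⋆
    spanBit-not false = refl
    spanBit-not true  = refl
    face : faceOf f ≡ ⋆ ∷ faceOf R
    face = trans (cong₂ (zipWith spanBit) (f≗ false zeros) (f≗ true ones))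
                 (cong (_∷ faceOf R) (spanBit-not d))

classify : ∀ s t (f : Vert m → Vert n) → Hom s t f → DimPres s f →
  NormalForm (s xor t) (faceOf f) f
classify {n = zero}  s t f hom dp = normalForm-into-point (s xor t) f
classify {n = suc n} s t f hom dp with headShape hom dp
... | constant c f≗ =
  normalForm-cons c f≗ (subst (λ d → NormalForm d _ _) (xor-swap s (not c) t)
    (classify s (not c xor t) (tail ∘ f) (tail-hom f≗ hom) (tail-dimPres f≗ dp)))
... | split f≗ =
  normalForm-⋆ f≗ (subst (λ d → NormalForm d _ _) (xor-same s)
    (classify s s R (subst (λ r → Hom s r R) (not-not-xor-cancel s t)
                           (tail-hom (f≗ true) (restrict-hom true hom)))
                    (tail-dimPres (f≗ true) (restrict-dimPres true {f} dp))))
  where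
    R = λ v → tail (f (true ∷ v))

dpmor-normalForm : (f : DPMor m n) → NormalForm false (faceOf (fun f)) (fun f)
dpmor-normalForm f = classify false false (fun f) (dpmor-hom f) (dpmor-dimPres f)

faceOf-injective : (f f′ : DPMor m n) → faceOf (fun f) ≡ faceOf (fun f′) →
  ∀ v → fun f v ≡ fun f′ v
faceOf-injective f f′ eq v = trans (proj₂ (dpmor-normalForm f) v)
  (trans (cong (λ φ → canonical φ v) eq) (sym (proj₂ (dpmor-normalForm f′) v)))

factorise : (f : DPMor m n) → Σ (Fact m n) λ F → ∀ v → composite F v ≡ fun f v
factorise f = F , λ v → sym (proj₂ (dpmor-normalForm f) v)
  where
    φ = faceOf (fun f)
    le = proj₁ (dpmor-normalForm f)
    F : Fact _ _
    F = record { k = faceDim φ ; g = projectMor (faceDim φ) ; h = embedMor φ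
               ; gSurj = λ w → padRight le false w , project-padRight le w
               ; hInj = λ a b → embed-injective false φ }

module FactNormalForm {m n} (F : Fact m n) where

  χ : Face n
  χ = faceOf (fun (h F))

  private
    g-normal = dpmor-normalForm (g F)
    h-normal = dpmor-normalForm (h F)
    ψ-full : faceOf (fun (g F)) ≡ replicate (k F) ⋆
    ψ-full = embed-surjective⇒full false (faceOf (fun (g F))) λ w →
      project _ (proj₁ (gSurj F w)) , trans (sym (proj₂ g-normal _)) (proj₂ (gSurj F w))

  g≗project : ∀ v → fun (g F) v ≡ project (k F) v
  g≗project v =
    trans (proj₂ g-normal v) (trans (cong (λ φ → canonical φ v) ψ-full) (canonical-full (k F) v))

  k≤m : k F ≤ m
  k≤m = subst (_≤ m) (trans (cong faceDim ψ-full) (faceDim-full (k F))) (proj₁ g-normal)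

  h≗canonical : ∀ w → fun (h F) w ≡ canonical χ w
  h≗canonical = proj₂ h-normal

  faceDim-χ : faceDim χ ≡ k F
  faceDim-χ = project-injective⇒≡ (proj₁ h-normal) λ a b eq →
    hInj F a b (trans (h≗canonical a) (trans (cong (embed false χ) eq) (sym (h≗canonical b))))

  faceOf-composite : faceOf (composite F) ≡ χ
  faceOf-composite =
    trans (faceOf-cong (cong (fun (h F)) ∘ g≗project)) (faceOf-∘project (fun (h F)) k≤m)

factorisations-agree : ∀ {i j} (e : i ≡ j) (χ : Face n)
  {g₁ : Vert m → Vert i} {g₂ : Vert m → Vert j} {h₁ : Vert i → Vert n} {h₂ : Vert j → Vert n} →
  g₁ ≗ project i → g₂ ≗ project j → h₁ ≗ canonical χ → h₂ ≗ canonical χ →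
  (∀ v → subst Vert e (g₁ v) ≡ g₂ v) × (∀ w → h₁ w ≡ h₂ (subst Vert e w))
factorisations-agree refl χ g₁≗ g₂≗ h₁≗ h₂≗ =
  (λ v → trans (g₁≗ v) (sym (g₂≗ v))) , (λ w → trans (h₁≗ w) (sym (h₂≗ w)))

factorisation-unique : (F F′ : Fact m n) → (∀ v → composite F v ≡ composite F′ v) → FactEq F F′
factorisation-unique F F′ eq =
  k≡k′ , factorisations-agree k≡k′ U.χ U.g≗project U′.g≗project U.h≗canonical
           (λ w → trans (U′.h≗canonical w) (cong (λ φ → canonical φ w) (sym χ≡χ′)))
  where
    module U  = FactNormalForm F
    module U′ = FactNormalForm F′
    χ≡χ′ : U.χ ≡ U′.χ
    χ≡χ′ = trans (sym U.faceOf-composite) (trans (faceOf-cong eq) U′.faceOf-composite)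
    k≡k′ : k F ≡ k F′
    k≡k′ = trans (sym U.faceDim-χ) (trans (cong faceDim χ≡χ′) U′.faceDim-χ)

lemma3p14 : (m n : ℕ) →
    ( ((f : DPMor m n) → Σ (Fact m n) λ F → ∀ v → composite F v ≡ fun f v)
    × (∀ (F F' : Fact m n) → (∀ v → composite F v ≡ composite F' v) → FactEq F F') )
    × Σ (DPMor m n → Σ (Face n) λ φ → faceDim φ ≤ m) λ Φ →
        (∀ f f' → (∀ v → fun f v ≡ fun f' v) → proj₁ (Φ f) ≡ proj₁ (Φ f'))
      × (∀ f f' → proj₁ (Φ f) ≡ proj₁ (Φ f') → ∀ v → fun f v ≡ fun f' v)
      × (∀ (φ : Face n) → faceDim φ ≤ m → ∃ λ f → proj₁ (Φ f) ≡ φ)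
lemma3p14 m n =
  (factorise , factorisation-unique) ,
  (λ f → faceOf (fun f) , proj₁ (dpmor-normalForm f)) ,
  (λ f f′ → faceOf-cong) ,
  faceOf-injective ,
  λ φ le → canonicalMor φ , faceOf-canonical φ le
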